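{- Consider a Max-$k$-Coverage instance $(U,\mathcal M,k)$, let $\mathcal S=\{S_1,\dots,S_k\}$ be the output of the greedy algorithm with $S_1$ the first subset it selects, and let $\mathcal S^\ast$ be an optimal solution. Let $\varepsilon>0$ (possibly depending on $k$). If $|S_1|\ge(\frac1k+\varepsilon)\mathrm{val}(\mathcal S^\ast)$, then $$\mathrm{val}(\mathcal S)\ge\Big(1-\big(1-\tfrac1k\big)^k+\tfrac{\varepsilon}8\Big)\mathrm{val}(\mathcal S^\ast).$$
   Context: A Max-$k$-Coverage instance consists of a finite universe $U$, a collection $\mathcal M$ of subsets of $U$ with $|\mathcal M|\ge k$, and a positive integer $k$. For a collection $\mathcal C\subseteq\mathcal M$, $\mathrm{val}(\mathcal C)=\big|\bigcup_{T\in\mathcal C}T\big|$. An optimal solution is a collection of $k$ members of $\mathcal M$ maximizing $\mathrm{val}$. The greedy algorithm selects $k$ members of $\mathcal M$ one at a time, each time choosing a member maximizing the increase of $\mathrm{val}$ of the collection selected so far. -}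

module Defs where

open import Data.Nat using (ℕ; zero; suc; _≤_)
open import Data.Integer using (+_)
open import Data.Rational using (ℚ; _/_; _*_; 1ℚ)
open import Data.Fin using (Fin)
open import Data.Fin.Subset using (Subset; ⋃; ∣_∣)
open import Data.List using (List; []; _∷_; map)
open import Data.List.Membership.Propositional using (_∉_)

-- Universe U = Fin n; a set system M = an indexed family Fin m → Subset n
-- A collection of members of M is given by a list of indices.

val : ∀ {n m} → (Fin m → Subset n) → List (Fin m) → ℕ
val M C = ∣ ⋃ (map M C) ∣

ℕ→ℚ : ℕ → ℚ
ℕ→ℚ a = + a / 1

_^ℚ_ : ℚ → ℕ → ℚ
p ^ℚ zero = 1ℚ
p ^ℚ suc e = p * (p ^ℚ e)

-- Greedy M S : S is a possible run of the greedy algorithm, listed with the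
-- MOST RECENTLY chosen index first (so the first selected member is the
-- last element of the list).
data Greedy {n m : ℕ} (M : Fin m → Subset n) : List (Fin m) → Set where
  start : Greedy M []
  pick  : ∀ {S : List (Fin m)} (i : Fin m) →
          Greedy M S →
          i ∉ S →
          (∀ (j : Fin m) → val M (j ∷ S) ≤ val M (i ∷ S)) →
          Greedy M (i ∷ S)

module Submission where

-- Coverage is submodular: adding a member to a collection gains at least as
-- much as adding it to a larger collection.  Hence, if T is the collection
-- chosen so far and i the next greedy pick, the k members of a solution O
-- together gain at least val O − val T over T, so one of them (and therefore
-- i) gains at least (val O − val T)/k.  The uncovered part val O − val T thus
-- shrinks by a factor q = 1 − 1/k with every pick, while the hypothesis on S₁
-- makes it at most (q − ε) val O after the first pick.  After k picks it is at
-- most q^(k−1) (q − ε) val O, and q^(k−1) ≥ 1/8.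

module SubsetCardinality where

  open import Data.Nat using (suc; _+_; _≤_; z≤n; s≤s)
  open import Data.Nat.Properties using (≤-trans; n≤1+n; +-suc)
  open import Data.Vec using ([]; _∷_; here)
  open import Data.Fin.Subset using (Subset; inside; outside; ∣_∣; _∪_; _⊆_)
  open import Data.Fin.Subset.Properties using (drop-∷-⊆)
  open import Relation.Nullary using (contradiction)
  open import Relation.Binary.PropositionalEquality using (sym; subst)

  +-suc-swap-≤ : ∀ a {b} c {d} → a + b ≤ c + d → suc a + b ≤ c + suc d
  +-suc-swap-≤ a {b} c {d} a+b≤c+d = subst (suc a + b ≤_) (sym (+-suc c d)) (s≤s a+b≤c+d)

  +-suc-mono-≤ : ∀ a {b} c {d} → a + b ≤ c + d → suc a + suc b ≤ suc c + suc d
  +-suc-mono-≤ a {b} c {d} a+b≤c+d = s≤s (subst (_≤ c + suc d) (sym (+-suc a b)) (+-suc-swap-≤ a c a+b≤c+d))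

  ∣p∪q∣+∣r∣≤∣p∪r∣+∣q∣ : ∀ {n} (p q r : Subset n) → r ⊆ q → ∣ p ∪ q ∣ + ∣ r ∣ ≤ ∣ p ∪ r ∣ + ∣ q ∣
  ∣p∪q∣+∣r∣≤∣p∪r∣+∣q∣ [] [] [] _ = z≤n
  ∣p∪q∣+∣r∣≤∣p∪r∣+∣q∣ (_ ∷ p) (outside ∷ q) (inside ∷ r) r⊆q = contradiction (r⊆q here) λ ()
  ∣p∪q∣+∣r∣≤∣p∪r∣+∣q∣ (inside ∷ p) (inside ∷ q) (inside ∷ r) r⊆q =
    +-suc-mono-≤ ∣ p ∪ q ∣ ∣ p ∪ r ∣ (∣p∪q∣+∣r∣≤∣p∪r∣+∣q∣ p q r (drop-∷-⊆ r⊆q))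
  ∣p∪q∣+∣r∣≤∣p∪r∣+∣q∣ (outside ∷ p) (inside ∷ q) (inside ∷ r) r⊆q =
    +-suc-mono-≤ ∣ p ∪ q ∣ ∣ p ∪ r ∣ (∣p∪q∣+∣r∣≤∣p∪r∣+∣q∣ p q r (drop-∷-⊆ r⊆q))
  ∣p∪q∣+∣r∣≤∣p∪r∣+∣q∣ (inside ∷ p) (inside ∷ q) (outside ∷ r) r⊆q =
    ≤-trans (+-suc-swap-≤ ∣ p ∪ q ∣ ∣ p ∪ r ∣ (∣p∪q∣+∣r∣≤∣p∪r∣+∣q∣ p q r (drop-∷-⊆ r⊆q))) (n≤1+n _)
  ∣p∪q∣+∣r∣≤∣p∪r∣+∣q∣ (outside ∷ p) (inside ∷ q) (outside ∷ r) r⊆q =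
    +-suc-swap-≤ ∣ p ∪ q ∣ ∣ p ∪ r ∣ (∣p∪q∣+∣r∣≤∣p∪r∣+∣q∣ p q r (drop-∷-⊆ r⊆q))
  ∣p∪q∣+∣r∣≤∣p∪r∣+∣q∣ (inside ∷ p) (outside ∷ q) (outside ∷ r) r⊆q =
    s≤s (∣p∪q∣+∣r∣≤∣p∪r∣+∣q∣ p q r (drop-∷-⊆ r⊆q))
  ∣p∪q∣+∣r∣≤∣p∪r∣+∣q∣ (outside ∷ p) (outside ∷ q) (outside ∷ r) r⊆q =
    ∣p∪q∣+∣r∣≤∣p∪r∣+∣q∣ p q r (drop-∷-⊆ r⊆q)

module Coverage where

  open import Defs using (val)
  open import Data.Nat using (ℕ; _+_; _*_; _≤_; z≤n)
  open import Data.Nat.Properties using (≤-refl; +-assoc; +-comm; +-mono-≤; +-monoˡ-≤; +-monoʳ-≤; module ≤-Reasoning)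
  open import Data.Nat.ListAction using (sum)
  open import Data.Fin using (Fin)
  open import Data.Fin.Subset using (Subset; ⋃; ∣_∣; _∪_; _⊆_)
  open import Data.Fin.Subset.Properties using (q⊆p∪q; ∣p∣≤∣p∪q∣; ∪-assoc; ∪-identityˡ)
  open SubsetCardinality using (∣p∪q∣+∣r∣≤∣p∪r∣+∣q∣)
  open import Data.List using (List; []; _∷_; _++_; map; length)
  open import Relation.Binary.PropositionalEquality using (_≡_; sym; trans; cong; subst)

  sum-map-≤-length* : ∀ {A : Set} (f : A → ℕ) {w} → (∀ x → f x ≤ w) → ∀ xs → sum (map f xs) ≤ length xs * w
  sum-map-≤-length* f f≤w []       = z≤n
  sum-map-≤-length* f f≤w (x ∷ xs) = +-mono-≤ (f≤w x) (sum-map-≤-length* f f≤w xs)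

  module _ {n m : ℕ} (M : Fin m → Subset n) where

    cover : List (Fin m) → Subset n
    cover C = ⋃ (map M C)

    cover-++ : ∀ O T → cover (O ++ T) ≡ cover O ∪ cover T
    cover-++ []      T = sym (∪-identityˡ (cover T))
    cover-++ (j ∷ O) T = trans (cong (M j ∪_) (cover-++ O T)) (sym (∪-assoc (M j) (cover O) (cover T)))

    cover-⊆-++ʳ : ∀ O T → cover T ⊆ cover (O ++ T)
    cover-⊆-++ʳ O T = subst (cover T ⊆_) (sym (cover-++ O T)) (q⊆p∪q (cover O) (cover T))

    val-≤-++ʳ : ∀ O T → val M O ≤ val M (O ++ T)
    val-≤-++ʳ O T = subst (val M O ≤_) (cong ∣_∣ (sym (cover-++ O T))) (∣p∣≤∣p∪q∣ (cover O) (cover T))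

    gains : List (Fin m) → List (Fin m) → ℕ
    gains T O = sum (map (λ j → val M (j ∷ T)) O)

    val-++-submodular : ∀ O T → val M (O ++ T) + length O * val M T ≤ val M T + gains T O
    val-++-submodular []      T = ≤-refl
    val-++-submodular (j ∷ O) T = begin
        val M (j ∷ O ++ T) + (vT + length O * vT)   ≡⟨ +-assoc (val M (j ∷ O ++ T)) vT _ ⟨
        val M (j ∷ O ++ T) + vT + length O * vT     ≤⟨ +-monoˡ-≤ _ (∣p∪q∣+∣r∣≤∣p∪r∣+∣q∣ (M j) _ _ (cover-⊆-++ʳ O T)) ⟩
        vjT + val M (O ++ T) + length O * vT        ≡⟨ +-assoc vjT (val M (O ++ T)) _ ⟩
        vjT + (val M (O ++ T) + length O * vT)      ≤⟨ +-monoʳ-≤ vjT (val-++-submodular O T) ⟩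
        vjT + (vT + gains T O)                      ≡⟨ +-assoc vjT vT _ ⟨
        vjT + vT + gains T O                        ≡⟨ cong (_+ gains T O) (+-comm vjT vT) ⟩
        vT + vjT + gains T O                        ≡⟨ +-assoc vT vjT _ ⟩
        vT + (vjT + gains T O)                      ∎
      where
      open ≤-Reasoning
      vT = val M T
      vjT = val M (j ∷ T)

    greedy-gain : ∀ O T i → (∀ j → val M (j ∷ T) ≤ val M (i ∷ T)) →
                  val M O + length O * val M T ≤ val M T + length O * val M (i ∷ T)
    greedy-gain O T i i-best = begin
      val M O + length O * val M T         ≤⟨ +-monoˡ-≤ _ (val-≤-++ʳ O T) ⟩
      val M (O ++ T) + length O * val M T  ≤⟨ val-++-submodular O T ⟩
      val M T + gains T O                  ≤⟨ +-monoʳ-≤ (val M T) (sum-map-≤-length* _ i-best O) ⟩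
      val M T + length O * val M (i ∷ T)   ∎
      where open ≤-Reasoning

module RationalBounds where

  open import Defs using (ℕ→ℚ; _^ℚ_)
  open import Data.Nat as ℕ using (ℕ; zero; suc; z≤n; s≤s)
  import Data.Nat.Properties as ℕₚ
  open import Data.Integer as ℤ using (+_)
  import Data.Integer.Properties as ℤₚ
  import Data.Nat.Coprimality as Coprimality
  open import Data.Rational using (toℚᵘ; _/_; _+_; _-_; _*_; -_; 0ℚ; 1ℚ; _≤_; *≤*; nonNegative)
  open import Data.Rational.Properties
  import Data.Rational.Unnormalised as ℚᵘ
  import Data.Rational.Unnormalised.Properties as ℚᵘₚ
  open import Data.Rational.Solver using (module +-*-Solver)
  open +-*-Solver using (solve; _:=_; con; _:+_; _:*_; _:-_)
  open import Data.Product using (∃; _×_; _,_)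
  open import Relation.Binary.PropositionalEquality using (_≡_; refl; sym; trans; cong; cong₂; subst; subst₂; module ≡-Reasoning)

  ℕ→ℚ-toℚᵘ : ∀ a → toℚᵘ (ℕ→ℚ a) ≡ ℚᵘ.mkℚᵘ (+ a) 0
  ℕ→ℚ-toℚᵘ a = cong toℚᵘ (normalize-coprime (Coprimality.sym (Coprimality.1-coprimeTo a)))

  ℕ→ℚ-+ : ∀ a b → ℕ→ℚ (a ℕ.+ b) ≡ ℕ→ℚ a + ℕ→ℚ b
  ℕ→ℚ-+ a b = toℚᵘ-injective (ℚᵘₚ.≃-trans lhs (ℚᵘₚ.≃-sym (toℚᵘ-homo-+ (ℕ→ℚ a) (ℕ→ℚ b))))
    where
    lhs : toℚᵘ (ℕ→ℚ (a ℕ.+ b)) ℚᵘ.≃ toℚᵘ (ℕ→ℚ a) ℚᵘ.+ toℚᵘ (ℕ→ℚ b)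
    lhs rewrite ℕ→ℚ-toℚᵘ (a ℕ.+ b) | ℕ→ℚ-toℚᵘ a | ℕ→ℚ-toℚᵘ b = ℚᵘ.*≡* (begin
      + (a ℕ.+ b) ℤ.* + 1              ≡⟨ ℤₚ.*-identityʳ _ ⟩
      + (a ℕ.+ b)                      ≡⟨ ℤₚ.pos-+ a b ⟩
      + a ℤ.+ + b                      ≡⟨ cong₂ ℤ._+_ (ℤₚ.*-identityʳ (+ a)) (ℤₚ.*-identityʳ (+ b)) ⟨
      + a ℤ.* + 1 ℤ.+ + b ℤ.* + 1      ≡⟨ ℤₚ.*-identityʳ _ ⟨
      (+ a ℤ.* + 1 ℤ.+ + b ℤ.* + 1) ℤ.* + 1 ∎)
      where open ≡-Reasoning

  ℕ→ℚ-* : ∀ a b → ℕ→ℚ (a ℕ.* b) ≡ ℕ→ℚ a * ℕ→ℚ b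
  ℕ→ℚ-* a b = toℚᵘ-injective (ℚᵘₚ.≃-trans lhs (ℚᵘₚ.≃-sym (toℚᵘ-homo-* (ℕ→ℚ a) (ℕ→ℚ b))))
    where
    lhs : toℚᵘ (ℕ→ℚ (a ℕ.* b)) ℚᵘ.≃ toℚᵘ (ℕ→ℚ a) ℚᵘ.* toℚᵘ (ℕ→ℚ b)
    lhs rewrite ℕ→ℚ-toℚᵘ (a ℕ.* b) | ℕ→ℚ-toℚᵘ a | ℕ→ℚ-toℚᵘ b =
      ℚᵘ.*≡* (trans (ℤₚ.*-identityʳ _) (trans (ℤₚ.pos-* a b) (sym (ℤₚ.*-identityʳ _))))

  ℕ→ℚ-+-* : ∀ a b c → ℕ→ℚ (a ℕ.+ b ℕ.* c) ≡ ℕ→ℚ a + ℕ→ℚ b * ℕ→ℚ c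
  ℕ→ℚ-+-* a b c = trans (ℕ→ℚ-+ a (b ℕ.* c)) (cong (λ x → ℕ→ℚ a + x) (ℕ→ℚ-* b c))

  ℕ→ℚ-mono-≤ : ∀ {a b} → a ℕ.≤ b → ℕ→ℚ a ≤ ℕ→ℚ b
  ℕ→ℚ-mono-≤ {a} {b} a≤b = toℚᵘ-cancel-≤ (subst₂ ℚᵘ._≤_ (sym (ℕ→ℚ-toℚᵘ a)) (sym (ℕ→ℚ-toℚᵘ b))
    (ℚᵘ.*≤* (subst₂ ℤ._≤_ (sym (ℤₚ.*-identityʳ _)) (sym (ℤₚ.*-identityʳ _)) (ℤ.+≤+ a≤b))))

  ℕ→ℚ-nonNeg : ∀ a → 0ℚ ≤ ℕ→ℚ a
  ℕ→ℚ-nonNeg a = ℕ→ℚ-mono-≤ {0} {a} z≤n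

  ℕ→ℚ*1/ℕ≡1 : ∀ k' → ℕ→ℚ (suc k') * (+ 1 / suc k') ≡ 1ℚ
  ℕ→ℚ*1/ℕ≡1 k' = toℚᵘ-injective (ℚᵘₚ.≃-trans (toℚᵘ-homo-* (ℕ→ℚ (suc k')) (+ 1 / suc k'))
    (ℚᵘₚ.≃-trans (ℚᵘₚ.*-cong (ℚᵘₚ.≃-reflexive (ℕ→ℚ-toℚᵘ (suc k'))) (toℚᵘ-fromℚᵘ (ℚᵘ.mkℚᵘ (+ 1) k')))
      (ℚᵘ.*≡* (cong (λ x → + suc x) (trans (trans (ℕₚ.*-identityʳ _) (ℕₚ.*-identityʳ _))
                                            (sym (trans (ℕₚ.+-identityʳ _) (ℕₚ.+-identityʳ _))))))))

  ≤-by-gap : ∀ {p q} d → q ≡ p + d → 0ℚ ≤ d → p ≤ q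
  ≤-by-gap {p} {q} d q≡p+d 0≤d = subst (p ≤_) (sym q≡p+d) (subst (_≤ p + d) (+-identityʳ p) (+-monoʳ-≤ p 0≤d))

  p≤q⇒0≤q-p : ∀ {p q} → p ≤ q → 0ℚ ≤ q - p
  p≤q⇒0≤q-p {p} {q} p≤q = subst (_≤ q - p) (+-inverseʳ p) (+-monoˡ-≤ (- p) p≤q)

  0≤p+q : ∀ {p q} → 0ℚ ≤ p → 0ℚ ≤ q → 0ℚ ≤ p + q
  0≤p+q {p} {q} 0≤p 0≤q = nonNegative⁻¹ (p + q) {{nonNeg+nonNeg⇒nonNeg p {{nonNegative 0≤p}} q {{nonNegative 0≤q}}}}

  0≤p*q : ∀ {p q} → 0ℚ ≤ p → 0ℚ ≤ q → 0ℚ ≤ p * q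
  0≤p*q {p} {q} 0≤p 0≤q = nonNegative⁻¹ (p * q) {{nonNeg*nonNeg⇒nonNeg p {{nonNegative 0≤p}} q {{nonNegative 0≤q}}}}

  *-monoˡ-≤-0≤ : ∀ {r p q} → 0ℚ ≤ r → p ≤ q → r * p ≤ r * q
  *-monoˡ-≤-0≤ {r} 0≤r = *-monoˡ-≤-nonNeg r {{nonNegative 0≤r}}

  *-monoʳ-≤-0≤ : ∀ {r p q} → 0ℚ ≤ r → p ≤ q → p * r ≤ q * r
  *-monoʳ-≤-0≤ {r} 0≤r = *-monoʳ-≤-nonNeg r {{nonNegative 0≤r}}

  ^ℚ-+ : ∀ p a b → p ^ℚ (a ℕ.+ b) ≡ p ^ℚ a * p ^ℚ b
  ^ℚ-+ p zero    b = sym (*-identityˡ _)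
  ^ℚ-+ p (suc a) b = trans (cong (p *_) (^ℚ-+ p a b)) (sym (*-assoc p _ _))

  ^ℚ-nonNeg : ∀ {p} → 0ℚ ≤ p → ∀ t → 0ℚ ≤ p ^ℚ t
  ^ℚ-nonNeg 0≤p zero    = *≤* (ℤ.+≤+ z≤n)
  ^ℚ-nonNeg 0≤p (suc t) = 0≤p*q 0≤p (^ℚ-nonNeg 0≤p t)

  ^ℚ-≤1 : ∀ {p} → 0ℚ ≤ p → p ≤ 1ℚ → ∀ t → p ^ℚ t ≤ 1ℚ
  ^ℚ-≤1 0≤p p≤1 zero    = ≤-refl
  ^ℚ-≤1 {p} 0≤p p≤1 (suc t) =
    ≤-trans (*-monoˡ-≤-0≤ 0≤p (^ℚ-≤1 0≤p p≤1 t)) (subst (_≤ 1ℚ) (sym (*-identityʳ p)) p≤1)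

  ^ℚ-antitone : ∀ {p} → 0ℚ ≤ p → p ≤ 1ℚ → ∀ {a b} → a ℕ.≤ b → p ^ℚ b ≤ p ^ℚ a
  ^ℚ-antitone {p} 0≤p p≤1 {a} {b} a≤b = begin
    p ^ℚ b                       ≡⟨ cong (p ^ℚ_) (ℕₚ.m+[n∸m]≡n a≤b) ⟨
    p ^ℚ (a ℕ.+ (b ℕ.∸ a))       ≡⟨ ^ℚ-+ p a (b ℕ.∸ a) ⟩
    p ^ℚ a * p ^ℚ (b ℕ.∸ a)      ≤⟨ *-monoˡ-≤-0≤ (^ℚ-nonNeg 0≤p a) (^ℚ-≤1 0≤p p≤1 (b ℕ.∸ a)) ⟩
    p ^ℚ a * 1ℚ                  ≡⟨ *-identityʳ _ ⟩
    p ^ℚ a                       ∎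
    where open ≤-Reasoning

  ^ℚ-mono-* : ∀ {c p t} → 0ℚ ≤ c → c ≤ p ^ℚ t → ∀ m → c ^ℚ m ≤ p ^ℚ (m ℕ.* t)
  ^ℚ-mono-* 0≤c c≤pᵗ zero = ≤-refl
  ^ℚ-mono-* {c} {p} {t} 0≤c c≤pᵗ (suc m) =
    subst (c * c ^ℚ m ≤_) (sym (^ℚ-+ p t (m ℕ.* t)))
      (≤-trans (*-monoʳ-≤-0≤ (^ℚ-nonNeg 0≤c m) c≤pᵗ)
               (*-monoˡ-≤-0≤ (≤-trans 0≤c c≤pᵗ) (^ℚ-mono-* 0≤c c≤pᵗ m)))

  bernoulli : ∀ {r} → 0ℚ ≤ r → r ≤ 1ℚ → ∀ t → 1ℚ - ℕ→ℚ t * r ≤ (1ℚ - r) ^ℚ t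
  bernoulli {r} 0≤r r≤1 zero = ≤-by-gap (ℕ→ℚ 0 * r)
    (solve 2 (λ T r → con 1ℚ := (con 1ℚ :- T :* r) :+ T :* r) refl (ℕ→ℚ 0) r) (0≤p*q (ℕ→ℚ-nonNeg 0) 0≤r)
  bernoulli {r} 0≤r r≤1 (suc t) = begin
    1ℚ - ℕ→ℚ (suc t) * r              ≤⟨ ≤-by-gap (T * (r * r)) expand (0≤p*q (ℕ→ℚ-nonNeg t) (0≤p*q 0≤r 0≤r)) ⟩
    (1ℚ - r) * (1ℚ - T * r)           ≤⟨ *-monoˡ-≤-0≤ (p≤q⇒0≤q-p r≤1) (bernoulli 0≤r r≤1 t) ⟩
    (1ℚ - r) * (1ℚ - r) ^ℚ t          ∎
    where
    open ≤-Reasoning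
    T = ℕ→ℚ t
    expand : (1ℚ - r) * (1ℚ - T * r) ≡ (1ℚ - ℕ→ℚ (suc t) * r) + T * (r * r)
    expand = trans
      (solve 2 (λ T r → (con 1ℚ :- r) :* (con 1ℚ :- T :* r) := (con 1ℚ :- (con 1ℚ :+ T) :* r) :+ T :* (r :* r)) refl T r)
      (cong (λ x → (1ℚ - x * r) + T * (r * r)) (sym (ℕ→ℚ-+ 1 t)))

  split-in-thirds : ∀ n → ∃ λ t → 2 ℕ.* t ℕ.≤ suc n × n ℕ.≤ 3 ℕ.* t
  split-in-thirds zero          = 0 , z≤n , z≤n
  split-in-thirds (suc zero)    = 1 , s≤s (s≤s z≤n) , s≤s z≤n
  split-in-thirds (suc (suc n)) with split-in-thirds n
  ... | t , 2t≤1+n , n≤3t =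
    suc t , subst (ℕ._≤ suc (suc (suc n))) (sym (ℕₚ.*-suc 2 t)) (s≤s (s≤s 2t≤1+n))
          , subst (suc (suc n) ℕ.≤_) (sym (ℕₚ.*-suc 3 t)) (ℕₚ.≤-trans (s≤s (s≤s n≤3t)) (ℕₚ.n≤1+n _))

  module _ (k' : ℕ) where

    private
      k = suc k'
      r = + 1 / k
      q = 1ℚ - r

    0≤1/k : 0ℚ ≤ r
    0≤1/k = nonNegative⁻¹ r {{normalize-nonNeg 1 k}}

    1/k≤1 : r ≤ 1ℚ
    1/k≤1 = subst₂ _≤_ (*-identityˡ r) (ℕ→ℚ*1/ℕ≡1 k') (*-monoʳ-≤-0≤ 0≤1/k (ℕ→ℚ-mono-≤ {1} {k} (s≤s z≤n)))

    0≤1-1/k : 0ℚ ≤ q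
    0≤1-1/k = p≤q⇒0≤q-p 1/k≤1

    -- Bernoulli gives q^t ≥ 1/2 whenever 2t ≤ k, and k − 1 ≤ 3t then yields q^(k−1) ≥ (1/2)³.
    1/8≤[1-1/k]^[k-1] : + 1 / 8 ≤ q ^ℚ k'
    1/8≤[1-1/k]^[k-1] with split-in-thirds k'
    ... | t , 2t≤k , k'≤3t =
      ≤-trans (^ℚ-mono-* {+ 1 / 2} {q} {t} (*≤* (ℤ.+≤+ z≤n)) 1/2≤qᵗ 3) (^ℚ-antitone 0≤1-1/k q≤1 k'≤3t)
      where
      q≤1 : q ≤ 1ℚ
      q≤1 = ≤-by-gap r (solve 1 (λ r → con 1ℚ := (con 1ℚ :- r) :+ r) refl r) 0≤1/k
      2t/k≤1 : ℕ→ℚ (2 ℕ.* t) * r ≤ 1ℚ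
      2t/k≤1 = subst (ℕ→ℚ (2 ℕ.* t) * r ≤_) (ℕ→ℚ*1/ℕ≡1 k') (*-monoʳ-≤-0≤ 0≤1/k (ℕ→ℚ-mono-≤ 2t≤k))
      1/2≤qᵗ : + 1 / 2 ≤ q ^ℚ t
      1/2≤qᵗ = ≤-trans (≤-by-gap ((1ℚ - ℕ→ℚ (2 ℕ.* t) * r) * (+ 1 / 2)) halve
                                  (0≤p*q (p≤q⇒0≤q-p 2t/k≤1) (*≤* (ℤ.+≤+ z≤n))))
                       (bernoulli 0≤1/k 1/k≤1 t)
        where
        halve : 1ℚ - ℕ→ℚ t * r ≡ + 1 / 2 + (1ℚ - ℕ→ℚ (2 ℕ.* t) * r) * (+ 1 / 2)
        halve = trans
          (solve 2 (λ T r → con 1ℚ :- T :* r := con (+ 1 / 2) :+ (con 1ℚ :- (con (ℕ→ℚ 2) :* T) :* r) :* con (+ 1 / 2))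
                 refl (ℕ→ℚ t) r)
          (cong (λ x → + 1 / 2 + (1ℚ - x * r) * (+ 1 / 2)) (sym (ℕ→ℚ-* 2 t)))

  contraction-step : ∀ K r V A A' → K * r ≡ 1ℚ → 0ℚ ≤ r → V + K * A ≤ A + K * A' → V - A' ≤ (1ℚ - r) * (V - A)
  contraction-step K r V A A' Kr≡1 0≤r V+KA≤A+KA' =
    ≤-by-gap (r * ((A + K * A') - (V + K * A))) identity (0≤p*q 0≤r (p≤q⇒0≤q-p V+KA≤A+KA'))
    where
    open ≡-Reasoning
    E = (V - A') + r * ((A + K * A') - (V + K * A))
    identity : (1ℚ - r) * (V - A) ≡ E
    identity = begin
      (1ℚ - r) * (V - A)
        ≡⟨ solve 5 (λ K r V A A' → (con 1ℚ :- r) :* (V :- A)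
                      := ((V :- A') :+ r :* ((A :+ K :* A') :- (V :+ K :* A))) :+ (con 1ℚ :- K :* r) :* (A' :- A))
                   refl K r V A A' ⟩
      E + (1ℚ - K * r) * (A' - A)   ≡⟨ cong (λ x → E + (1ℚ - x) * (A' - A)) Kr≡1 ⟩
      E + 0ℚ * (A' - A)             ≡⟨ cong (λ x → E + x) (*-zeroˡ (A' - A)) ⟩
      E + 0ℚ                        ≡⟨ +-identityʳ E ⟩
      E                             ∎

  first-pick-bound : ∀ r ε V A → (r + ε) * V ≤ A → V - A ≤ (1ℚ - r - ε) * V
  first-pick-bound r ε V A [r+ε]V≤A = ≤-by-gap (A - (r + ε) * V)
    (solve 4 (λ V A ε r → ((con 1ℚ :- r) :- ε) :* V := (V :- A) :+ (A :- (r :+ ε) :* V)) refl V A ε r)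
    (p≤q⇒0≤q-p [r+ε]V≤A)

  ratio-bound : ∀ q {P c ε V A} → 0ℚ ≤ ε → 0ℚ ≤ V → c ≤ P → V - A ≤ P * ((q - ε) * V) →
                (1ℚ - q * P + ε * c) * V ≤ A
  ratio-bound q {P} {c} {ε} {V} {A} 0≤ε 0≤V c≤P V-A≤P[q-ε]V =
    ≤-by-gap ((P * ((q - ε) * V) - (V - A)) + (P - c) * (ε * V))
      (solve 6 (λ V A P c ε q → A := (con 1ℚ :- q :* P :+ ε :* c) :* V :+ ((P :* ((q :- ε) :* V) :- (V :- A)) :+ (P :- c) :* (ε :* V)))
             refl V A P c ε q)
      (0≤p+q (p≤q⇒0≤q-p V-A≤P[q-ε]V) (0≤p*q (p≤q⇒0≤q-p c≤P) (0≤p*q 0≤ε 0≤V)))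

open import Defs
open import Data.Nat using (ℕ; NonZero; _≤_)
open import Data.Integer using (+_)
open import Data.Rational using (ℚ; _/_; _+_; _-_; _*_; 1ℚ; 0ℚ) renaming (_≤_ to _≤ℚ_; _<_ to _<ℚ_)
open import Data.Fin using (Fin)
open import Data.Fin.Subset using (Subset)
open import Data.List using (List; []; _∷_; _++_; length)
open import Data.List.Relation.Unary.Unique.Propositional using (Unique)
open import Relation.Binary.PropositionalEquality using (_≡_; refl; sym; trans; subst; subst₂)

import Data.Nat as ℕ
open import Data.Nat.Properties using (+-comm)
open import Data.List.Properties using (length-++)
open import Data.Rational.Properties using (<⇒≤; *-assoc; *-identityˡ; module ≤-Reasoning)
open Coverage using (greedy-gain)
open RationalBounds

module _ {n m : ℕ} (M : Fin m → Subset n) (O : List (Fin m)) (k' : ℕ) (ε : ℚ) (s₁ : Fin m) where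

  private
    V = ℕ→ℚ (val M O)
    q = 1ℚ - + 1 / ℕ.suc k'

  uncovered-after-greedy : length O ≡ ℕ.suc k' → ((+ 1 / ℕ.suc k') + ε) * V ≤ℚ ℕ→ℚ (val M (s₁ ∷ [])) →
                           ∀ T → Greedy M (T ++ s₁ ∷ []) →
                           V - ℕ→ℚ (val M (T ++ s₁ ∷ [])) ≤ℚ q ^ℚ length T * ((q - ε) * V)
  uncovered-after-greedy lenO first [] _ =
    subst (V - ℕ→ℚ (val M (s₁ ∷ [])) ≤ℚ_) (sym (*-identityˡ _)) (first-pick-bound (+ 1 / ℕ.suc k') ε V _ first)
  uncovered-after-greedy lenO first (i ∷ T) (pick .i run _ i-best) = begin
    V - ℕ→ℚ g'                              ≤⟨ contraction-step K (+ 1 / ℕ.suc k') V (ℕ→ℚ g) (ℕ→ℚ g') (ℕ→ℚ*1/ℕ≡1 k') (0≤1/k k') gain ⟩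
    q * (V - ℕ→ℚ g)                         ≤⟨ *-monoˡ-≤-0≤ (0≤1-1/k k') (uncovered-after-greedy lenO first T run) ⟩
    q * (q ^ℚ length T * ((q - ε) * V))     ≡⟨ *-assoc q _ _ ⟨
    q ^ℚ length (i ∷ T) * ((q - ε) * V)     ∎
    where
    open ≤-Reasoning
    g = val M (T ++ s₁ ∷ [])
    g' = val M (i ∷ T ++ s₁ ∷ [])
    K = ℕ→ℚ (ℕ.suc k')
    gain : V + K * ℕ→ℚ g ≤ℚ ℕ→ℚ g + K * ℕ→ℚ g'
    gain = subst₂ _≤ℚ_ (ℕ→ℚ-+-* (val M O) (ℕ.suc k') g) (ℕ→ℚ-+-* g (ℕ.suc k') g')
      (ℕ→ℚ-mono-≤ (subst (λ c → val M O ℕ.+ c ℕ.* g ≤ g ℕ.+ c ℕ.* g') lenO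
                          (greedy-gain M O (T ++ s₁ ∷ []) i i-best)))

lemma12 : ∀ {n m : ℕ} (M : Fin m → Subset n) (k : ℕ) .{{_ : NonZero k}} →
          k ≤ m →
          (S : List (Fin m)) (s₁ : Fin m) → Greedy M (S ++ (s₁ ∷ [])) → length (S ++ (s₁ ∷ [])) ≡ k →
          (O : List (Fin m)) → length O ≡ k → Unique O →
          (∀ (C : List (Fin m)) → length C ≡ k → Unique C → val M C ≤ val M O) →
          (ε : ℚ) → 0ℚ <ℚ ε →
          ((+ 1 / k) + ε) * ℕ→ℚ (val M O) ≤ℚ ℕ→ℚ (val M (s₁ ∷ [])) →
          (1ℚ - (1ℚ - (+ 1 / k)) ^ℚ k + ε * (+ 1 / 8)) * ℕ→ℚ (val M O) ≤ℚ ℕ→ℚ (val M (S ++ (s₁ ∷ [])))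
lemma12 M k _ S s₁ run len O lenO _ _ ε 0<ε first
  with refl ← trans (+-comm 1 (length S)) (trans (sym (length-++ S)) len) =
  ratio-bound (1ℚ - + 1 / k) (<⇒≤ 0<ε) (ℕ→ℚ-nonNeg (val M O)) (1/8≤[1-1/k]^[k-1] (length S))
    (uncovered-after-greedy M O (length S) ε s₁ lenO first S run)
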